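{- Let $n\ge1$, $n_0,n_1\ge0$ with $n_0+n_1=n$, and let $C$ be a color map on the triangular lattice of size $n$ such that each boundary side carries exactly $n_0$ edges of color $0$ and $n_1$ edges of color $1$. For $j\in\{0,1\}$ let $n^{(j)}$ (resp. $n_{(j)}$) be the number of direct (resp. reversed) triangular faces all of whose edges have color $j$. Then $$n^{(j)}=\frac{n_j(n_j+1)}{2}\quad\text{and}\quad n_{(j)}=\frac{n_j(n_j-1)}{2}.$$
   Context: Let $\xi=e^{i\pi/3}$ and $T_n=\{r+s\xi:\ r,s\in\mathbb{Z}_{\ge0},\ r+s\le n\}$. Edges are the segments $[z,z+w]$ with $z,z+w\in T_n$, $w\in\{1,\xi,\bar\xi\}$. Faces are unit triangles with vertices in $T_n$; a face is direct if its vertices are $y,y+1,y+\xi$ and reversed if they are $y,y+1,y+\bar\xi$. A color map is a map $C$ from edges to $\{0,1,3,m\}$ such that for every face the colors of its three edges read in clockwise order form, up to cyclic rotation, one of $(0,0,0)$, $(1,1,1)$, $(1,0,3)$, $(0,1,m)$. The three boundary sides are the bottom edges $[k-1,k]$, the right edges $[(k-1)+(n-k+1)\xi,k+(n-k)\xi]$ and the left edges $[(k-1)\xi,k\xi]$, $1\le k\le n$. -}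

module Defs where

open import Data.Nat using (ℕ; zero; suc; _+_; _∸_; _<_; _≤_; _<?_; s≤s)
open import Data.Nat.Properties using (+-identityʳ; +-suc; m+[n∸m]≡n; ≤-reflexive; ≤-trans; n≤1+n)
open import Data.Fin using (Fin; toℕ)
open import Data.Fin.Properties using (toℕ<n)
open import Data.List using (List; tabulate)
open import Data.Nat.ListAction using (sum)
open import Data.Product using (_×_; _,_)
open import Data.Sum using (_⊎_)
open import Relation.Binary.PropositionalEquality using (_≡_; refl; subst; sym)
open import Relation.Nullary using (Dec; yes; no)

data Color : Set where
  c0 c1 c3 cm : Color

_≟c_ : (a b : Color) → Dec (a ≡ b)
c0 ≟c c0 = yes refl
c1 ≟c c1 = yes refl
c3 ≟c c3 = yes refl
cm ≟c cm = yes refl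
c0 ≟c c1 = no (λ ())
c0 ≟c c3 = no (λ ())
c0 ≟c cm = no (λ ())
c1 ≟c c0 = no (λ ())
c1 ≟c c3 = no (λ ())
c1 ≟c cm = no (λ ())
c3 ≟c c0 = no (λ ())
c3 ≟c c1 = no (λ ())
c3 ≟c cm = no (λ ())
cm ≟c c0 = no (λ ())
cm ≟c c1 = no (λ ())
cm ≟c c3 = no (λ ())

-- A point r + s ξ of T_n is encoded by (r , s).
-- Edge directions, each edge indexed by (r , s) with r + s < n:
--   hor r s : [ r + s ξ , (r+1) + s ξ ]          (w = 1)
--   up  r s : [ r + s ξ , r + (s+1) ξ ]          (w = ξ)
--   dia r s : [ r + (s+1) ξ , (r+1) + s ξ ]      (w = ξ̄ = 1 - ξ)
-- This enumerates every edge of T_n exactly once.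
data Dir : Set where
  hor up dia : Dir

record Edge (n : ℕ) : Set where
  constructor edge
  field
    dir : Dir
    r s : ℕ
    inT : r + s < n

ColorMap : ℕ → Set
ColorMap n = Edge n → Color

CycEq : Color → Color → Color → Color → Color → Color → Set
CycEq a b c x y z =
  (a ≡ x × b ≡ y × c ≡ z) ⊎ (a ≡ y × b ≡ z × c ≡ x) ⊎ (a ≡ z × b ≡ x × c ≡ y)

Allowed : Color → Color → Color → Set
Allowed a b c =
  CycEq a b c c0 c0 c0 ⊎ CycEq a b c c1 c1 c1 ⊎ CycEq a b c c1 c0 c3 ⊎ CycEq a b c c0 c1 cm

revHorBound : ∀ {n} r s → suc (r + s) < n → r + suc s < n
revHorBound {n} r s p = subst (_< n) (sym (+-suc r s)) p

revDiaBound : ∀ {n} r s → suc (r + s) < n → r + s < n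
revDiaBound r s p = ≤-trans (n≤1+n _) p

-- Direct face with y = r + s ξ (requires r + s + 1 ≤ n), vertices y, y+1, y+ξ.
-- Clockwise: y → y+ξ → y+1 → y, i.e. edges up r s, dia r s, hor r s.
-- Reversed face with y = r + (s+1) ξ (requires r + s + 2 ≤ n), vertices y, y+1, y+ξ̄.
-- Clockwise: y → y+1 → y+ξ̄ → y, i.e. edges hor r (s+1), up (r+1) s, dia r s.
IsColorMap : (n : ℕ) → ColorMap n → Set
IsColorMap n C =
  (∀ r s (p : r + s < n) →
     Allowed (C (edge up r s p)) (C (edge dia r s p)) (C (edge hor r s p)))
  × (∀ r s (p : suc (r + s) < n) →
     Allowed (C (edge hor r (suc s) (revHorBound r s p)))
             (C (edge up (suc r) s p))
             (C (edge dia r s (revDiaBound r s p))))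

[_] : ∀ {P : Set} → Dec P → ℕ
[ yes _ ] = 1
[ no _ ] = 0

Σ< : (n : ℕ) → (Fin n → ℕ) → ℕ
Σ< n f = sum (tabulate f)

bottomBound : ∀ {n} k → k < n → k + 0 < n
bottomBound {n} k p = subst (_< n) (sym (+-identityʳ k)) p

rightBound : ∀ {n} k → k < n → k + (n ∸ suc k) < n
rightBound {n} k p = ≤-reflexive (m+[n∸m]≡n p)

-- bottom edges [k-1,k], right edges [(k-1)+(n-k+1)ξ, k+(n-k)ξ], left edges [(k-1)ξ, kξ]
-- (indexed by i = k-1 ∈ {0,…,n-1})
bottomCount : (n : ℕ) → ColorMap n → Color → ℕ
bottomCount n C c = Σ< n (λ i → [ C (edge hor (toℕ i) 0 (bottomBound (toℕ i) (toℕ<n i))) ≟c c ])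

rightCount : (n : ℕ) → ColorMap n → Color → ℕ
rightCount n C c = Σ< n (λ i → [ C (edge dia (toℕ i) (n ∸ suc (toℕ i)) (rightBound (toℕ i) (toℕ<n i))) ≟c c ])

leftCount : (n : ℕ) → ColorMap n → Color → ℕ
leftCount n C c = Σ< n (λ i → [ C (edge up 0 (toℕ i) (toℕ<n i)) ≟c c ])

allColor : Color → Color → Color → Color → ℕ
allColor c a b d with a ≟c c | b ≟c c | d ≟c c
... | yes _ | yes _ | yes _ = 1
... | _ | _ | _ = 0

directInd : (n : ℕ) → ColorMap n → Color → ℕ → ℕ → ℕ
directInd n C c r s with r + s <? n
... | yes p = allColor c (C (edge up r s p)) (C (edge dia r s p)) (C (edge hor r s p))
... | no _ = 0

reversedInd : (n : ℕ) → ColorMap n → Color → ℕ → ℕ → ℕ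
reversedInd n C c r s with suc (r + s) <? n
... | yes p = allColor c (C (edge hor r (suc s) (revHorBound r s p)))
                         (C (edge up (suc r) s p))
                         (C (edge dia r s (revDiaBound r s p)))
... | no _ = 0

directMono : (n : ℕ) → ColorMap n → Color → ℕ
directMono n C c = Σ< n (λ r → Σ< n (λ s → directInd n C c (toℕ r) (toℕ s)))

reversedMono : (n : ℕ) → ColorMap n → Color → ℕ
reversedMono n C c = Σ< n (λ r → Σ< n (λ s → reversedInd n C c (toℕ r) (toℕ s)))

-- By the colour symmetry 0 ↔ 1, 3 ↔ m it suffices to count the faces of colour 0.  Every interior
-- edge of T n lies on exactly one direct and one reversed face and every boundary edge on one direct
-- face only, so any function on edges, summed along the direct faces, equals its sum along the
-- reversed faces plus its sum over the boundary.  For a colour weight under which an allowed face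
-- weighs 3 if it is monochromatic 0 and 0 otherwise, this gives n⁽⁰⁾ − n₍₀₎ = n₀.  Sending 0-edges
-- to their direction vectors and collapsing 1-edges (mixed edges get whatever closes up the faces)
-- defines a lattice map of T n into ℤ² that takes the monochromatic 0-faces onto triangles of
-- area 1/2 and flattens all other faces.  For the shoelace form of this map the same identity says
-- that n⁽⁰⁾ + n₍₀₎ is twice the area enclosed by the image of the boundary, the triangle with
-- vertices (0, 0), (n₀, 0), (0, n₀); so n⁽⁰⁾ + n₍₀₎ = n₀².

module Submission where

open import Data.Fin.Base using (Fin; toℕ)
open import Data.Integer.Base using (ℤ; +_; -_; 0ℤ; 1ℤ; -1ℤ)
import Data.Integer.Properties as ℤ
import Data.Integer.Tactic.RingSolver as ℤ-Solver
import Data.Nat.Tactic.RingSolver as ℕ-Solver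
open import Data.Nat.Base as ℕ using (ℕ; zero; suc; _≤_; _<_; _∸_; z≤n; s≤s; z<s; s<s)
import Data.Nat.Properties as ℕ
open import Data.Nat.Properties using (_<?_)
open import Data.List.Properties using (tabulate-cong)
open import Data.Nat.ListAction using (sum)
open import Data.Product using (_×_; _,_; proj₁; proj₂)
open import Data.Sum as Sum using (_⊎_; inj₁; inj₂)
open import Function using (_∘_)
open import Relation.Nullary using (yes; no; contradiction)
open import Relation.Binary.PropositionalEquality
  using (_≡_; refl; sym; trans; cong; cong₂; subst; module ≡-Reasoning)

open import Defs

-- Sums over ranges and over triangles

module _ where
  open import Data.Integer.Base using (_+_; _*_)
  open import Algebra.Properties.CommutativeSemigroup ℤ.+-commutativeSemigroup using (interchange)
  open ≡-Reasoning

  ∑ : ℕ → (ℕ → ℤ) → ℤ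
  ∑ zero    f = 0ℤ
  ∑ (suc n) f = f 0 + ∑ n (f ∘ suc)

  ∑-cong : ∀ n {f g : ℕ → ℤ} → (∀ {i} → i < n → f i ≡ g i) → ∑ n f ≡ ∑ n g
  ∑-cong zero    eq = refl
  ∑-cong (suc n) eq = cong₂ _+_ (eq z<s) (∑-cong n (eq ∘ s<s))

  ∑-0 : ∀ n {f : ℕ → ℤ} → (∀ {i} → i < n → f i ≡ 0ℤ) → ∑ n f ≡ 0ℤ
  ∑-0 zero    eq = refl
  ∑-0 (suc n) eq = cong₂ _+_ (eq z<s) (∑-0 n (eq ∘ s<s))

  ∑-last : ∀ n (f : ℕ → ℤ) → ∑ (suc n) f ≡ ∑ n f + f n
  ∑-last zero    f = trans (ℤ.+-identityʳ (f 0)) (sym (ℤ.+-identityˡ (f 0)))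
  ∑-last (suc n) f = trans (cong (_+_ (f 0)) (∑-last n (f ∘ suc))) (sym (ℤ.+-assoc (f 0) _ _))

  ∑-+ : ∀ n (f g : ℕ → ℤ) → ∑ n (λ i → f i + g i) ≡ ∑ n f + ∑ n g
  ∑-+ zero    f g = refl
  ∑-+ (suc n) f g = trans (cong (_+_ (f 0 + g 0)) (∑-+ n (f ∘ suc) (g ∘ suc))) (interchange (f 0) (g 0) _ _)

  ∑-+₃ : ∀ n (f g h : ℕ → ℤ) → ∑ n (λ i → f i + g i + h i) ≡ ∑ n f + ∑ n g + ∑ n h
  ∑-+₃ n f g h = trans (∑-+ n _ h) (cong (_+ ∑ n h) (∑-+ n f g))

  ∑-* : ∀ n k (f : ℕ → ℤ) → ∑ n (λ i → k * f i) ≡ k * ∑ n f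
  ∑-* zero    k f = sym (ℤ.*-zeroʳ k)
  ∑-* (suc n) k f = trans (cong (_+_ (k * f 0)) (∑-* n k (f ∘ suc))) (sym (ℤ.*-distribˡ-+ k (f 0) _))

  ∑-truncate : ∀ {m n} (f : ℕ → ℤ) → m ≤ n → (∀ {i} → m ≤ i → f i ≡ 0ℤ) → ∑ n f ≡ ∑ m f
  ∑-truncate {n = n} f z≤n       vanish = ∑-0 n (λ _ → vanish z≤n)
  ∑-truncate         f (s≤s m≤n) vanish = cong (_+_ (f 0)) (∑-truncate (f ∘ suc) m≤n (vanish ∘ s≤s))

  Σ<-∑ : ∀ n (f : ℕ → ℕ) → + Σ< n (f ∘ toℕ) ≡ ∑ n (+_ ∘ f)
  Σ<-∑ zero    f = refl
  Σ<-∑ (suc n) f = trans (ℤ.pos-+ (f 0) _) (cong (_+_ (+ f 0)) (Σ<-∑ n (f ∘ suc)))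

  Σ<²-∑ : ∀ n (f : ℕ → ℕ → ℕ) →
          + Σ< n (λ r → Σ< n (λ s → f (toℕ r) (toℕ s))) ≡ ∑ n (λ r → ∑ n (λ s → + f r s))
  Σ<²-∑ n f = trans (Σ<-∑ n (λ r → Σ< n (f r ∘ toℕ))) (∑-cong n (λ {r} _ → Σ<-∑ n (f r)))

  ∑Δ : ℕ → (ℕ → ℕ → ℤ) → ℤ
  ∑Δ n f = ∑ n (λ r → ∑ (n ∸ r) (f r))

  ∑Δ-cong : ∀ n {f g : ℕ → ℕ → ℤ} → (∀ {r s} → r ℕ.+ s < n → f r s ≡ g r s) → ∑Δ n f ≡ ∑Δ n g
  ∑Δ-cong n eq = ∑-cong n λ {r} r<n → ∑-cong (n ∸ r) λ {s} s<n∸r →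
    eq (subst (r ℕ.+ s <_) (ℕ.m+[n∸m]≡n (ℕ.<⇒≤ r<n)) (ℕ.+-monoʳ-< r s<n∸r))

  ∑Δ-* : ∀ n k (f : ℕ → ℕ → ℤ) → ∑Δ n (λ r s → k * f r s) ≡ k * ∑Δ n f
  ∑Δ-* n k f = trans (∑-cong n (λ {r} _ → ∑-* (n ∸ r) k (f r))) (∑-* n k _)

  ∑□≡∑Δ : ∀ {m n} (f : ℕ → ℕ → ℤ) → m ≤ n → (∀ {r s} → m ≤ r ℕ.+ s → f r s ≡ 0ℤ) →
          ∑ n (λ r → ∑ n (f r)) ≡ ∑Δ m f
  ∑□≡∑Δ {m} {n} f m≤n vanish = begin
    ∑ n (λ r → ∑ n (f r))   ≡⟨ ∑-truncate _ m≤n (λ m≤r → ∑-0 n (λ _ → vanish (ℕ.m≤n⇒m≤n+o _ m≤r))) ⟩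
    ∑ m (λ r → ∑ n (f r))   ≡⟨ ∑-cong m (λ {r} _ → ∑-truncate (f r) (m∸r≤n r) (vanish ∘ m≤r+s r)) ⟩
    ∑Δ m f                  ∎
    where
    m∸r≤n : ∀ r → m ∸ r ≤ n
    m∸r≤n r = ℕ.≤-trans (ℕ.m∸n≤m m r) m≤n
    m≤r+s : ∀ r {s} → m ∸ r ≤ s → m ≤ r ℕ.+ s
    m≤r+s r m∸r≤s = ℕ.≤-trans (ℕ.m≤n+m∸n m r) (ℕ.+-monoʳ-≤ r m∸r≤s)

-- Double counting over the faces of the triangle

module _ where
  open import Data.Integer.Base using (_+_)
  open ≡-Reasoning

  -- Over T (suc n); faces are summed from their horizontal edge on, counterclockwise for direct
  -- and clockwise for reversed faces.
  directSum reversedSum boundarySum : ℕ → (Dir → ℕ → ℕ → ℤ) → ℤ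
  directSum n w   = ∑Δ (suc n) (λ r s → w hor r s + w dia r s + w up r s)
  reversedSum n w = ∑Δ n (λ r s → w hor r (suc s) + w up (suc r) s + w dia r s)
  boundarySum n w = ∑ (suc n) (λ r → w hor r 0) + ∑ (suc n) (w up 0) + ∑ (suc n) (λ r → w dia r (n ∸ r))

  private
    shiftʳ : (Dir → ℕ → ℕ → ℤ) → Dir → ℕ → ℕ → ℤ
    shiftʳ w e r = w e (suc r)

    firstColumn : ∀ m (w : Dir → ℕ → ℕ → ℤ) →
      ∑ (suc m) (λ s → w hor 0 s + w dia 0 s + w up 0 s) + ∑ m (w up 1)
      ≡ ∑ m (λ s → w hor 0 (suc s) + w up 1 s + w dia 0 s) + (w hor 0 0 + ∑ (suc m) (w up 0) + w dia 0 m)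
    firstColumn m w = begin
      ∑ (suc m) (λ s → h s + d s + u s) + U₁
        ≡⟨ cong (_+ U₁) (∑-+₃ (suc m) h d u) ⟩
      h 0 + H + ∑ (suc m) d + U₀ + U₁
        ≡⟨ cong (λ x → h 0 + H + x + U₀ + U₁) (∑-last m d) ⟩
      h 0 + H + (D + d m) + U₀ + U₁
        ≡⟨ regroup (h 0) H D (d m) U₀ U₁ ⟩
      H + U₁ + D + (h 0 + U₀ + d m)
        ≡⟨ cong (_+ (h 0 + U₀ + d m)) (sym (∑-+₃ m (h ∘ suc) (w up 1) d)) ⟩
      ∑ m (λ s → h (suc s) + w up 1 s + d s) + (h 0 + U₀ + d m) ∎
      where
      h d u : ℕ → ℤ
      h = w hor 0
      d = w dia 0
      u = w up 0
      H D U₀ U₁ : ℤ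
      H  = ∑ m (h ∘ suc)
      D  = ∑ m d
      U₀ = ∑ (suc m) u
      U₁ = ∑ m (w up 1)
      regroup : ∀ a H D e U₀ U₁ → a + H + (D + e) + U₀ + U₁ ≡ H + U₁ + D + (a + U₀ + e)
      regroup = ℤ-Solver.solve-∀

  -- Peels off the column r = 0 of faces.
  directSum≡reversedSum+boundarySum : ∀ n w → directSum n w ≡ reversedSum n w + boundarySum n w
  directSum≡reversedSum+boundarySum zero w = regroup (w hor 0 0) (w dia 0 0) (w up 0 0)
    where
    regroup : ∀ h d u → h + d + u + 0ℤ + 0ℤ ≡ 0ℤ + (h + 0ℤ + (u + 0ℤ) + (d + 0ℤ))
    regroup = ℤ-Solver.solve-∀
  directSum≡reversedSum+boundarySum (suc n) w = begin
    F + directSum n w′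
      ≡⟨ cong (_+_ F) (directSum≡reversedSum+boundarySum n w′) ⟩
    F + (R′ + (B₁ + U₁ + B₃))
      ≡⟨ regroup₁ F R′ B₁ U₁ B₃ ⟩
    F + U₁ + (R′ + B₁ + B₃)
      ≡⟨ cong (_+ (R′ + B₁ + B₃)) (firstColumn (suc n) w) ⟩
    G + (w hor 0 0 + U₀ + w dia 0 (suc n)) + (R′ + B₁ + B₃)
      ≡⟨ regroup₂ G (w hor 0 0) U₀ (w dia 0 (suc n)) R′ B₁ B₃ ⟩
    reversedSum (suc n) w + boundarySum (suc n) w ∎
    where
    w′ : Dir → ℕ → ℕ → ℤ
    w′ = shiftʳ w
    F G R′ B₁ U₀ U₁ B₃ : ℤ
    F  = ∑ (suc (suc n)) (λ s → w hor 0 s + w dia 0 s + w up 0 s)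
    G  = ∑ (suc n) (λ s → w hor 0 (suc s) + w up 1 s + w dia 0 s)
    R′ = reversedSum n w′
    B₁ = ∑ (suc n) (λ r → w′ hor r 0)
    U₀ = ∑ (suc (suc n)) (w up 0)
    U₁ = ∑ (suc n) (w up 1)
    B₃ = ∑ (suc n) (λ r → w′ dia r (n ∸ r))
    regroup₁ : ∀ F R B₁ U₁ B₃ → F + (R + (B₁ + U₁ + B₃)) ≡ F + U₁ + (R + B₁ + B₃)
    regroup₁ = ℤ-Solver.solve-∀
    regroup₂ : ∀ G a U₀ e R B₁ B₃ →
               G + (a + U₀ + e) + (R + B₁ + B₃) ≡ G + R + (a + B₁ + U₀ + (e + B₃))
    regroup₂ = ℤ-Solver.solve-∀

-- Lattice maps into ℤ²

module _ where
  open import Data.Integer.Base using (_+_; _-_; _*_)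
  open ≡-Reasoning

  ℤ² : Set
  ℤ² = ℤ × ℤ

  infixl 6 _+ᵥ_

  _+ᵥ_ : ℤ² → ℤ² → ℤ²
  (a , b) +ᵥ (c , d) = a + c , b + d

  cross : ℤ² → ℤ² → ℤ
  cross (a , b) (c , d) = a * d - b * c

  xy : ℤ² → ℤ
  xy (a , b) = a + b

  shoelace-triangle : ∀ p u v →
                      cross p (p +ᵥ u) + cross (p +ᵥ u) (p +ᵥ v) + cross (p +ᵥ v) p ≡ cross u v
  shoelace-triangle (x , y) (a , b) (c , d) = identity x y a b c d
    where
    identity : ∀ x y a b c d →
      x * (y + b) - y * (x + a) + ((x + a) * (y + d) - (y + b) * (x + c)) + ((x + c) * y - (y + d) * x)
      ≡ a * d - b * c
    identity = ℤ-Solver.solve-∀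

  xy-+ᵥ : ∀ p q → xy (p +ᵥ q) ≡ xy p + xy q
  xy-+ᵥ (a , b) (c , d) = identity a b c d
    where
    identity : ∀ a b c d → a + c + (b + d) ≡ a + b + (c + d)
    identity = ℤ-Solver.solve-∀

  +ᵥ-assoc : ∀ p q t → p +ᵥ q +ᵥ t ≡ p +ᵥ (q +ᵥ t)
  +ᵥ-assoc (a , b) (c , d) (e , f) = cong₂ _,_ (ℤ.+-assoc a c e) (ℤ.+-assoc b d f)

  +ᵥ-regroup : ∀ p u d u′ → p +ᵥ (u +ᵥ d) +ᵥ u′ ≡ p +ᵥ u +ᵥ (u′ +ᵥ d)
  +ᵥ-regroup (a , a′) (b , b′) (c , c′) (e , e′) = cong₂ _,_ (regroup a b c e) (regroup a′ b′ c′ e′)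
    where
    regroup : ∀ p u d u′ → p + (u + d) + u′ ≡ p + u + (u′ + d)
    regroup = ℤ-Solver.solve-∀

  cross-x-axis : ∀ a b → cross (a , 0ℤ) (b , 0ℤ) ≡ 0ℤ
  cross-x-axis = identity
    where
    identity : ∀ a b → a * 0ℤ - 0ℤ * b ≡ 0ℤ
    identity = ℤ-Solver.solve-∀

  cross-y-axis : ∀ a b → cross (0ℤ , a) (0ℤ , b) ≡ 0ℤ
  cross-y-axis = identity
    where
    identity : ∀ a b → 0ℤ * b - a * 0ℤ ≡ 0ℤ
    identity = ℤ-Solver.solve-∀

  cross-antidiagonal : ∀ p δ → cross (p +ᵥ (δ , - δ)) p ≡ xy p * δ
  cross-antidiagonal (a , b) δ = identity a b δ
    where
    identity : ∀ a b δ → (a + δ) * b - (b + - δ) * a ≡ (a + b) * δ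
    identity = ℤ-Solver.solve-∀

  cross-closed : ∀ {h} u d → h ≡ u +ᵥ d → cross h d ≡ -1ℤ * cross h u
  cross-closed (a , b) (c , d) refl = identity a b c d
    where
    identity : ∀ a b c d → (a + c) * d - (b + d) * c ≡ -1ℤ * ((a + c) * b - (b + d) * a)
    identity = ℤ-Solver.solve-∀

  -- Every edge is oriented so that direct faces are traversed counterclockwise.
  shoelace : (ℕ → ℕ → ℤ²) → Dir → ℕ → ℕ → ℤ
  shoelace P hor r s = cross (P r s) (P (suc r) s)
  shoelace P up  r s = cross (P r (suc s)) (P r s)
  shoelace P dia r s = cross (P (suc r) s) (P r (suc s))

  shoelace-direct : ∀ (P : ℕ → ℕ → ℤ²) {r s a b} →
                    P (suc r) s ≡ P r s +ᵥ a → P r (suc s) ≡ P r s +ᵥ b →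
                    shoelace P hor r s + shoelace P dia r s + shoelace P up r s ≡ cross a b
  shoelace-direct P {r} {s} {a} {b} eq₁ eq₂ =
    trans (cong₂ (λ q t → cross p q + cross q t + cross t p) eq₁ eq₂) (shoelace-triangle p a b)
    where
    p : ℤ²
    p = P r s

  shoelace-reversed : ∀ (P : ℕ → ℕ → ℤ²) {r s a b} →
                      P (suc r) (suc s) ≡ P r (suc s) +ᵥ a → P (suc r) s ≡ P r (suc s) +ᵥ b →
                      shoelace P hor r (suc s) + shoelace P up (suc r) s + shoelace P dia r s ≡ cross a b
  shoelace-reversed P {r} {s} {a} {b} eq₁ eq₂ =
    trans (cong₂ (λ q t → cross p q + cross q t + cross t p) eq₁ eq₂) (shoelace-triangle p a b)
    where
    p : ℤ²
    p = P r (suc s)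

  record Closed (n : ℕ) (v : Dir → ℕ → ℕ → ℤ²) : Set where
    field
      direct   : ∀ {r s} → r ℕ.+ s < n → v hor r s ≡ v up r s +ᵥ v dia r s
      reversed : ∀ {r s} → suc (r ℕ.+ s) < n → v hor r (suc s) ≡ v up (suc r) s +ᵥ v dia r s

  -- The clause order makes the first equation hold definitionally for every r.
  potential : (Dir → ℕ → ℕ → ℤ²) → ℕ → ℕ → ℤ²
  potential v r       (suc s) = potential v r s +ᵥ v up r s
  potential v (suc r) zero    = potential v r zero +ᵥ v hor r 0
  potential v zero    zero    = 0ℤ , 0ℤ

  potential-bottom : ∀ {N} (v : Dir → ℕ → ℕ → ℤ²) {a : ℕ → ℤ} →
                     (∀ {i} → i < N → v hor i 0 ≡ (a i , 0ℤ)) →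
                     ∀ {r} → r ≤ N → potential v r 0 ≡ (∑ r a , 0ℤ)
  potential-bottom v     eq {zero}  _   = refl
  potential-bottom v {a} eq {suc r} r<N = begin
    potential v r 0 +ᵥ v hor r 0   ≡⟨ cong₂ _+ᵥ_ (potential-bottom v eq (ℕ.<⇒≤ r<N)) (eq r<N) ⟩
    (∑ r a + a r , 0ℤ)             ≡⟨ cong (_, 0ℤ) (sym (∑-last r a)) ⟩
    (∑ (suc r) a , 0ℤ)             ∎

  potential-left : ∀ {N} (v : Dir → ℕ → ℕ → ℤ²) {b : ℕ → ℤ} →
                   (∀ {i} → i < N → v up 0 i ≡ (0ℤ , b i)) →
                   ∀ {s} → s ≤ N → potential v 0 s ≡ (0ℤ , ∑ s b)
  potential-left v     eq {zero}  _   = refl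
  potential-left v {b} eq {suc s} s<N = begin
    potential v 0 s +ᵥ v up 0 s    ≡⟨ cong₂ _+ᵥ_ (potential-left v eq (ℕ.<⇒≤ s<N)) (eq s<N) ⟩
    (0ℤ , ∑ s b + b s)             ≡⟨ cong (0ℤ ,_) (sym (∑-last s b)) ⟩
    (0ℤ , ∑ (suc s) b)             ∎

  module _ {n} {v : Dir → ℕ → ℕ → ℤ²} (closed : Closed n v) where
    open Closed closed

    potential-hor : ∀ {r s} → r ℕ.+ s < n → potential v (suc r) s ≡ potential v r s +ᵥ v hor r s
    potential-hor {r} {zero}  _ = refl
    potential-hor {r} {suc s} r+s+1<n = begin
      potential v (suc r) s +ᵥ v up (suc r) s
        ≡⟨ cong (_+ᵥ v up (suc r) s) (potential-hor {r} {s} r+s<n) ⟩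
      potential v r s +ᵥ v hor r s +ᵥ v up (suc r) s
        ≡⟨ cong (λ h → potential v r s +ᵥ h +ᵥ v up (suc r) s) (direct {r} {s} r+s<n) ⟩
      potential v r s +ᵥ (v up r s +ᵥ v dia r s) +ᵥ v up (suc r) s
        ≡⟨ +ᵥ-regroup (potential v r s) _ _ _ ⟩
      potential v r (suc s) +ᵥ (v up (suc r) s +ᵥ v dia r s)
        ≡⟨ cong (potential v r (suc s) +ᵥ_) (sym (reversed {r} {s} reversed-face)) ⟩
      potential v r (suc s) +ᵥ v hor r (suc s) ∎
      where
      reversed-face : suc (r ℕ.+ s) < n
      reversed-face = subst (_< n) (ℕ.+-suc r s) r+s+1<n
      r+s<n : r ℕ.+ s < n
      r+s<n = revDiaBound r s reversed-face

    potential-dia : ∀ {r s} → r ℕ.+ s < n → potential v (suc r) s ≡ potential v r (suc s) +ᵥ v dia r s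
    potential-dia {r} {s} r+s<n =
      trans (potential-hor {r} {s} r+s<n)
            (trans (cong (potential v r s +ᵥ_) (direct {r} {s} r+s<n)) (sym (+ᵥ-assoc (potential v r s) _ _)))

    potential-antidiagonal : (∀ {r k} → suc (r ℕ.+ k) ≡ n → xy (v dia r k) ≡ 0ℤ) →
                             ∀ k {r} → r ℕ.+ k ≡ n → xy (potential v r k) ≡ xy (potential v n 0)
    potential-antidiagonal flat zero    {r} r+0≡n =
      cong (λ r → xy (potential v r 0)) (trans (sym (ℕ.+-identityʳ r)) r+0≡n)
    potential-antidiagonal flat (suc k) {r} r+k+1≡n = begin
      xy (potential v r (suc k))                    ≡⟨ sym (ℤ.+-identityʳ _) ⟩
      xy (potential v r (suc k)) + 0ℤ               ≡⟨ cong (_+_ (xy (potential v r (suc k)))) (sym (flat e)) ⟩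
      xy (potential v r (suc k)) + xy (v dia r k)   ≡⟨ sym (xy-+ᵥ (potential v r (suc k)) _) ⟩
      xy (potential v r (suc k) +ᵥ v dia r k)       ≡⟨ cong xy (sym (potential-dia {r} {k} (ℕ.≤-reflexive e))) ⟩
      xy (potential v (suc r) k)                    ≡⟨ potential-antidiagonal flat k e ⟩
      xy (potential v n 0)                          ∎
      where
      e : suc (r ℕ.+ k) ≡ n
      e = trans (sym (ℕ.+-suc r k)) r+k+1≡n

-- Colours and colour maps

module _ where
  open import Data.Nat.Base using (_+_; _*_)
  open import Algebra.Properties.CommutativeSemigroup ℕ.+-commutativeSemigroup using (interchange)

  CycEq-rotate : ∀ {a b c x y z} → CycEq a b c x y z → CycEq b c a x y z
  CycEq-rotate (inj₁ (a≡x , b≡y , c≡z))        = inj₂ (inj₁ (b≡y , c≡z , a≡x))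
  CycEq-rotate (inj₂ (inj₁ (a≡y , b≡z , c≡x))) = inj₂ (inj₂ (b≡z , c≡x , a≡y))
  CycEq-rotate (inj₂ (inj₂ (a≡z , b≡x , c≡y))) = inj₁ (b≡x , c≡y , a≡z)

  Allowed-rotate : ∀ {a b c} → Allowed a b c → Allowed b c a
  Allowed-rotate = Sum.map CycEq-rotate (Sum.map CycEq-rotate (Sum.map CycEq-rotate CycEq-rotate))

  CycEq-map : ∀ (f : Color → Color) {a b c x y z} →
              CycEq a b c x y z → CycEq (f a) (f b) (f c) (f x) (f y) (f z)
  CycEq-map f = Sum.map cong³ (Sum.map cong³ cong³)
    where
    cong³ : ∀ {a b c x y z} → a ≡ x × b ≡ y × c ≡ z → f a ≡ f x × f b ≡ f y × f c ≡ f z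
    cong³ (a≡x , b≡y , c≡z) = cong f a≡x , cong f b≡y , cong f c≡z

  swap01 : Color → Color
  swap01 c0 = c1
  swap01 c1 = c0
  swap01 c3 = cm
  swap01 cm = c3

  swap01-involutive : ∀ c → swap01 (swap01 c) ≡ c
  swap01-involutive c0 = refl
  swap01-involutive c1 = refl
  swap01-involutive c3 = refl
  swap01-involutive cm = refl

  swap01-injective : ∀ {a b} → swap01 a ≡ swap01 b → a ≡ b
  swap01-injective {a} {b} eq =
    trans (sym (swap01-involutive a)) (trans (cong swap01 eq) (swap01-involutive b))

  Allowed-swap01 : ∀ {a b c} → Allowed a b c → Allowed (swap01 a) (swap01 b) (swap01 c)
  Allowed-swap01 = Sum.[ inj₂ ∘ inj₁ ∘ CycEq-map swap01
                 , Sum.[ inj₁ ∘ CycEq-map swap01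
                 , Sum.[ inj₂ ∘ inj₂ ∘ inj₂ ∘ CycEq-map swap01
                       , inj₂ ∘ inj₂ ∘ inj₁ ∘ CycEq-map swap01 ] ] ]

  [≟c]-injective : ∀ {f : Color → Color} → (∀ {a b} → f a ≡ f b → a ≡ b) →
                   ∀ a b → [ f a ≟c f b ] ≡ [ a ≟c b ]
  [≟c]-injective {f} inj a b with f a ≟c f b | a ≟c b
  ... | yes _     | yes _    = refl
  ... | no  _     | no  _    = refl
  ... | yes fa≡fb | no  a≢b  = contradiction (inj fa≡fb) a≢b
  ... | no  fa≢fb | yes refl = contradiction refl fa≢fb

  allColor≡∏ : ∀ j a b c → allColor j a b c ≡ [ a ≟c j ] * [ b ≟c j ] * [ c ≟c j ]
  allColor≡∏ j a b c with a ≟c j | b ≟c j | c ≟c j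
  ... | yes _ | yes _ | yes _ = refl
  ... | yes _ | yes _ | no  _ = refl
  ... | yes _ | no  _ | _     = refl
  ... | no  _ | _     | _     = refl

  allColor-rotate : ∀ j a b c → allColor j a b c ≡ allColor j b c a
  allColor-rotate j a b c = begin
    allColor j a b c                         ≡⟨ allColor≡∏ j a b c ⟩
    [ a ≟c j ] * [ b ≟c j ] * [ c ≟c j ]     ≡⟨ rotate [ a ≟c j ] [ b ≟c j ] [ c ≟c j ] ⟩
    [ b ≟c j ] * [ c ≟c j ] * [ a ≟c j ]     ≡⟨ sym (allColor≡∏ j b c a) ⟩
    allColor j b c a                         ∎
    where
    open ≡-Reasoning
    rotate : ∀ x y z → x * y * z ≡ y * z * x
    rotate = ℕ-Solver.solve-∀

  allColor-swap01 : ∀ j a b c → allColor (swap01 j) (swap01 a) (swap01 b) (swap01 c) ≡ allColor j a b c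
  allColor-swap01 j a b c
    rewrite allColor≡∏ (swap01 j) (swap01 a) (swap01 b) (swap01 c)
          | [≟c]-injective swap01-injective a j
          | [≟c]-injective swap01-injective b j
          | [≟c]-injective swap01-injective c j
          = sym (allColor≡∏ j a b c)

  -- Off T n the colour is a junk value.
  colour : ∀ {n} → ColorMap n → Dir → ℕ → ℕ → Color
  colour {n} C e r s with r + s <? n
  ... | yes p = C (edge e r s p)
  ... | no  _ = c1

  colour-edge : ∀ {n} (C : ColorMap n) e {r s} (p : r + s < n) → colour C e r s ≡ C (edge e r s p)
  colour-edge {n} C e {r} {s} p with r + s <? n
  ... | yes q  = cong (C ∘ edge e r s) (ℕ.<-irrelevant q p)
  ... | no  ¬p = contradiction p ¬p

  Allowed-cong : ∀ {a b c a′ b′ c′} → a ≡ a′ → b ≡ b′ → c ≡ c′ → Allowed a b c → Allowed a′ b′ c′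
  Allowed-cong refl refl refl allowed = allowed

  direct-Allowed : ∀ {n} {C : ColorMap n} → IsColorMap n C → ∀ {r s} (p : r + s < n) →
                   Allowed (colour C up r s) (colour C dia r s) (colour C hor r s)
  direct-Allowed {C = C} (direct , _) {r} {s} p =
    Allowed-cong (sym (colour-edge C up p)) (sym (colour-edge C dia p)) (sym (colour-edge C hor p)) (direct r s p)

  reversed-Allowed : ∀ {n} {C : ColorMap n} → IsColorMap n C → ∀ {r s} (p : suc (r + s) < n) →
                     Allowed (colour C up (suc r) s) (colour C dia r s) (colour C hor r (suc s))
  reversed-Allowed {C = C} (_ , reversed) {r} {s} p =
    Allowed-rotate (Allowed-cong (sym (colour-edge C hor (revHorBound r s p)))
                                 (sym (colour-edge C up {suc r} {s} p))
                                 (sym (colour-edge C dia (revDiaBound r s p)))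
                                 (reversed r s p))

  IsColorMap-swap01 : ∀ {n} {C : ColorMap n} → IsColorMap n C → IsColorMap n (swap01 ∘ C)
  IsColorMap-swap01 (direct , reversed) =
    (λ r s p → Allowed-swap01 (direct r s p)) , (λ r s p → Allowed-swap01 (reversed r s p))

  Σ<-cong : ∀ n {f g : Fin n → ℕ} → (∀ i → f i ≡ g i) → Σ< n f ≡ Σ< n g
  Σ<-cong n eq = cong sum (tabulate-cong eq)

  directInd-swap01 : ∀ {n} (C : ColorMap n) j r s →
                     directInd n (swap01 ∘ C) (swap01 j) r s ≡ directInd n C j r s
  directInd-swap01 {n} C j r s with r + s <? n
  ... | yes _ = allColor-swap01 j _ _ _
  ... | no  _ = refl

  reversedInd-swap01 : ∀ {n} (C : ColorMap n) j r s →
                       reversedInd n (swap01 ∘ C) (swap01 j) r s ≡ reversedInd n C j r s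
  reversedInd-swap01 {n} C j r s with suc (r + s) <? n
  ... | yes _ = allColor-swap01 j _ _ _
  ... | no  _ = refl

  directMono-swap01 : ∀ {n} (C : ColorMap n) j → directMono n (swap01 ∘ C) (swap01 j) ≡ directMono n C j
  directMono-swap01 {n} C j = Σ<-cong n λ r → Σ<-cong n λ s → directInd-swap01 C j (toℕ r) (toℕ s)

  reversedMono-swap01 : ∀ {n} (C : ColorMap n) j → reversedMono n (swap01 ∘ C) (swap01 j) ≡ reversedMono n C j
  reversedMono-swap01 {n} C j = Σ<-cong n λ r → Σ<-cong n λ s → reversedInd-swap01 C j (toℕ r) (toℕ s)

  SideCounts : (n : ℕ) → ColorMap n → Color → ℕ → Set
  SideCounts n C c m = bottomCount n C c ≡ m × rightCount n C c ≡ m × leftCount n C c ≡ m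

  SideCounts-swap01 : ∀ {n C c m} → SideCounts n C c m → SideCounts n (swap01 ∘ C) (swap01 c) m
  SideCounts-swap01 {n} {C} {c} (bottom , right , left) =
    trans (Σ<-cong n λ _ → swapped) bottom ,
    trans (Σ<-cong n λ _ → swapped) right ,
    trans (Σ<-cong n λ _ → swapped) left
    where
    swapped : ∀ {x} → [ swap01 x ≟c swap01 c ] ≡ [ x ≟c c ]
    swapped = [≟c]-injective swap01-injective _ c

  count : ℕ → (ℕ → Color) → Color → ℕ
  count n x c = Σ< n (λ i → [ x (toℕ i) ≟c c ])

  bottomSide leftSide rightSide : ∀ {n} → ColorMap n → ℕ → Color
  bottomSide C r = colour C hor r 0
  leftSide   C s = colour C up 0 s
  rightSide {n} C r = colour C dia r (n ∸ suc r)

  bottomCount≡count : ∀ {n} (C : ColorMap n) c → bottomCount n C c ≡ count n (bottomSide C) c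
  bottomCount≡count {n} C c = Σ<-cong n λ _ → cong (λ x → [ x ≟c c ]) (sym (colour-edge C hor _))

  leftCount≡count : ∀ {n} (C : ColorMap n) c → leftCount n C c ≡ count n (leftSide C) c
  leftCount≡count {n} C c = Σ<-cong n λ _ → cong (λ x → [ x ≟c c ]) (sym (colour-edge C up _))

  rightCount≡count : ∀ {n} (C : ColorMap n) c → rightCount n C c ≡ count n (rightSide C) c
  rightCount≡count {n} C c = Σ<-cong n λ _ → cong (λ x → [ x ≟c c ]) (sym (colour-edge C dia _))

  Binary : Color → Set
  Binary c = c ≡ c0 ⊎ c ≡ c1

  record BinarySide (n : ℕ) (x : ℕ → Color) (m : ℕ) : Set where
    field
      binary : ∀ {r} → r < n → Binary (x r)
      zeros  : count n x c0 ≡ m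

  private
    binaryIndicator : Color → ℕ
    binaryIndicator c = [ c ≟c c0 ] + [ c ≟c c1 ]

    binaryIndicator≤1 : ∀ c → binaryIndicator c ≤ 1
    binaryIndicator≤1 c0 = ℕ.≤-refl
    binaryIndicator≤1 c1 = ℕ.≤-refl
    binaryIndicator≤1 c3 = z≤n
    binaryIndicator≤1 cm = z≤n

    binaryIndicator≡1⇒Binary : ∀ c → binaryIndicator c ≡ 1 → Binary c
    binaryIndicator≡1⇒Binary c0 _ = inj₁ refl
    binaryIndicator≡1⇒Binary c1 _ = inj₂ refl

    split-count : ∀ n (x : ℕ → Color) →
                  count (suc n) x c0 + count (suc n) x c1
                  ≡ binaryIndicator (x 0) + (count n (x ∘ suc) c0 + count n (x ∘ suc) c1)
    split-count n x = interchange [ x 0 ≟c c0 ] _ [ x 0 ≟c c1 ] _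

    a+b≡1+n⇒a≡1×b≡n : ∀ {a b n} → a ≤ 1 → b ≤ n → a + b ≡ suc n → a ≡ 1 × b ≡ n
    a+b≡1+n⇒a≡1×b≡n z≤n       b≤n refl = contradiction b≤n ℕ.1+n≰n
    a+b≡1+n⇒a≡1×b≡n (s≤s z≤n) _   eq   = refl , ℕ.suc-injective eq

  count₀+count₁≤n : ∀ n x → count n x c0 + count n x c1 ≤ n
  count₀+count₁≤n zero    x = z≤n
  count₀+count₁≤n (suc n) x =
    subst (_≤ suc n) (sym (split-count n x))
          (ℕ.+-mono-≤ (binaryIndicator≤1 (x 0)) (count₀+count₁≤n n (x ∘ suc)))

  private
    head-and-tail : ∀ n x → count (suc n) x c0 + count (suc n) x c1 ≡ suc n →
                    binaryIndicator (x 0) ≡ 1 × count n (x ∘ suc) c0 + count n (x ∘ suc) c1 ≡ n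
    head-and-tail n x eq =
      a+b≡1+n⇒a≡1×b≡n (binaryIndicator≤1 (x 0)) (count₀+count₁≤n n (x ∘ suc)) (trans (sym (split-count n x)) eq)

  count₀+count₁≡n⇒Binary : ∀ n x → count n x c0 + count n x c1 ≡ n → ∀ {r} → r < n → Binary (x r)
  count₀+count₁≡n⇒Binary (suc n) x eq {zero}  _   = binaryIndicator≡1⇒Binary (x 0) (proj₁ (head-and-tail n x eq))
  count₀+count₁≡n⇒Binary (suc n) x eq {suc r} r<n =
    count₀+count₁≡n⇒Binary n (x ∘ suc) (proj₂ (head-and-tail n x eq)) (ℕ.s<s⁻¹ r<n)

  binarySide : ∀ {n x n₀ n₁} → count n x c0 ≡ n₀ → count n x c1 ≡ n₁ → n₀ + n₁ ≡ n → BinarySide n x n₀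
  binarySide {n} {x} zeros ones n₀+n₁≡n = record
    { binary = count₀+count₁≡n⇒Binary n x (trans (cong₂ _+_ zeros ones) n₀+n₁≡n)
    ; zeros  = zeros
    }

-- The lattice map of a colour map

module _ where
  open import Data.Integer.Base using (_+_; _*_)
  open import Algebra.Properties.CommutativeSemigroup ℤ.+-commutativeSemigroup using (xy∙z≈xz∙y)
  open ≡-Reasoning

  -- A 0-edge goes to its own direction 1, ξ or ξ̄ = 1 - ξ, in coordinates for the basis (1, ξ),
  -- a 1-edge collapses, and the mixed colours get the vectors forced by closing up the faces.
  edgeVector : Dir → Color → ℤ²
  edgeVector hor c0 = 1ℤ  , 0ℤ
  edgeVector hor c1 = 0ℤ  , 0ℤ
  edgeVector hor c3 = 1ℤ  , -1ℤ
  edgeVector hor cm = 0ℤ  , 1ℤ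
  edgeVector up  c0 = 0ℤ  , 1ℤ
  edgeVector up  c1 = 0ℤ  , 0ℤ
  edgeVector up  c3 = 1ℤ  , 0ℤ
  edgeVector up  cm = -1ℤ , 1ℤ
  edgeVector dia c0 = 1ℤ  , -1ℤ
  edgeVector dia c1 = 0ℤ  , 0ℤ
  edgeVector dia c3 = 0ℤ  , -1ℤ
  edgeVector dia cm = 1ℤ  , 0ℤ

  weight : Color → ℤ
  weight c0 = 1ℤ
  weight c1 = 0ℤ
  weight c3 = -1ℤ
  weight cm = -1ℤ

  record FaceLaws (u d h : Color) : Set where
    constructor mkFaceLaws
    field
      closed   : edgeVector hor h ≡ edgeVector up u +ᵥ edgeVector dia d
      area     : cross (edgeVector hor h) (edgeVector up u) ≡ + allColor c0 u d h
      weighted : weight h + weight d + weight u ≡ + 3 * + allColor c0 u d h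

  faceLaws : ∀ {u d h} → Allowed u d h → FaceLaws u d h
  faceLaws (inj₁ (inj₁ (refl , refl , refl)))                      = mkFaceLaws refl refl refl
  faceLaws (inj₁ (inj₂ (inj₁ (refl , refl , refl))))               = mkFaceLaws refl refl refl
  faceLaws (inj₁ (inj₂ (inj₂ (refl , refl , refl))))               = mkFaceLaws refl refl refl
  faceLaws (inj₂ (inj₁ (inj₁ (refl , refl , refl))))               = mkFaceLaws refl refl refl
  faceLaws (inj₂ (inj₁ (inj₂ (inj₁ (refl , refl , refl)))))        = mkFaceLaws refl refl refl
  faceLaws (inj₂ (inj₁ (inj₂ (inj₂ (refl , refl , refl)))))        = mkFaceLaws refl refl refl
  faceLaws (inj₂ (inj₂ (inj₁ (inj₁ (refl , refl , refl)))))        = mkFaceLaws refl refl refl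
  faceLaws (inj₂ (inj₂ (inj₁ (inj₂ (inj₁ (refl , refl , refl)))))) = mkFaceLaws refl refl refl
  faceLaws (inj₂ (inj₂ (inj₁ (inj₂ (inj₂ (refl , refl , refl)))))) = mkFaceLaws refl refl refl
  faceLaws (inj₂ (inj₂ (inj₂ (inj₁ (refl , refl , refl)))))        = mkFaceLaws refl refl refl
  faceLaws (inj₂ (inj₂ (inj₂ (inj₂ (inj₁ (refl , refl , refl)))))) = mkFaceLaws refl refl refl
  faceLaws (inj₂ (inj₂ (inj₂ (inj₂ (inj₂ (refl , refl , refl)))))) = mkFaceLaws refl refl refl

  weight-binary : ∀ {c} → Binary c → weight c ≡ + [ c ≟c c0 ]
  weight-binary (inj₁ refl) = refl
  weight-binary (inj₂ refl) = refl

  edgeVector-hor-binary : ∀ {c} → Binary c → edgeVector hor c ≡ (+ [ c ≟c c0 ] , 0ℤ)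
  edgeVector-hor-binary (inj₁ refl) = refl
  edgeVector-hor-binary (inj₂ refl) = refl

  edgeVector-up-binary : ∀ {c} → Binary c → edgeVector up c ≡ (0ℤ , + [ c ≟c c0 ])
  edgeVector-up-binary (inj₁ refl) = refl
  edgeVector-up-binary (inj₂ refl) = refl

  edgeVector-dia-binary : ∀ {c} → Binary c → edgeVector dia c ≡ (+ [ c ≟c c0 ] , - + [ c ≟c c0 ])
  edgeVector-dia-binary (inj₁ refl) = refl
  edgeVector-dia-binary (inj₂ refl) = refl

  xy-edgeVector-dia-binary : ∀ {c} → Binary c → xy (edgeVector dia c) ≡ 0ℤ
  xy-edgeVector-dia-binary (inj₁ refl) = refl
  xy-edgeVector-dia-binary (inj₂ refl) = refl

  directInd-inside : ∀ {n} (C : ColorMap n) j {r s} → r ℕ.+ s < n →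
                     directInd n C j r s ≡ allColor j (colour C up r s) (colour C dia r s) (colour C hor r s)
  directInd-inside {n} C j {r} {s} p with r ℕ.+ s <? n
  ... | yes _  = refl
  ... | no  ¬p = contradiction p ¬p

  directInd-outside : ∀ {n} (C : ColorMap n) j {r s} → n ≤ r ℕ.+ s → directInd n C j r s ≡ 0
  directInd-outside {n} C j {r} {s} n≤r+s with r ℕ.+ s <? n
  ... | yes p = contradiction n≤r+s (ℕ.<⇒≱ p)
  ... | no  _ = refl

  reversedInd-inside : ∀ {n} (C : ColorMap n) j {r s} → suc (r ℕ.+ s) < n →
                       reversedInd n C j r s
                       ≡ allColor j (colour C hor r (suc s)) (colour C up (suc r) s) (colour C dia r s)
  reversedInd-inside {n} C j {r} {s} p with suc (r ℕ.+ s) <? n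
  ... | yes q  = sym (cong₂ (λ h d → allColor j h (C (edge up (suc r) s q)) d)
                            (colour-edge C hor (revHorBound r s q)) (colour-edge C dia (revDiaBound r s q)))
  ... | no  ¬p = contradiction p ¬p

  reversedInd-outside : ∀ {n} (C : ColorMap (suc n)) j {r s} → n ≤ r ℕ.+ s → reversedInd (suc n) C j r s ≡ 0
  reversedInd-outside {n} C j {r} {s} n≤r+s with suc (r ℕ.+ s) <? suc n
  ... | yes p = contradiction (s≤s n≤r+s) (ℕ.<⇒≱ p)
  ... | no  _ = refl

  directMono≡∑Δ : ∀ {n} (C : ColorMap n) j →
    + directMono n C j ≡ ∑Δ n (λ r s → + allColor j (colour C up r s) (colour C dia r s) (colour C hor r s))
  directMono≡∑Δ {n} C j = begin
    + directMono n C j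
      ≡⟨ Σ<²-∑ n (directInd n C j) ⟩
    ∑ n (λ r → ∑ n (λ s → + directInd n C j r s))
      ≡⟨ ∑□≡∑Δ _ ℕ.≤-refl (cong +_ ∘ directInd-outside C j) ⟩
    ∑Δ n (λ r s → + directInd n C j r s)
      ≡⟨ ∑Δ-cong n (cong +_ ∘ directInd-inside C j) ⟩
    ∑Δ n (λ r s → + allColor j (colour C up r s) (colour C dia r s) (colour C hor r s)) ∎

  reversedMono≡∑Δ : ∀ {n} (C : ColorMap (suc n)) j →
    + reversedMono (suc n) C j
    ≡ ∑Δ n (λ r s → + allColor j (colour C hor r (suc s)) (colour C up (suc r) s) (colour C dia r s))
  reversedMono≡∑Δ {n} C j = begin
    + reversedMono (suc n) C j
      ≡⟨ Σ<²-∑ (suc n) (reversedInd (suc n) C j) ⟩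
    ∑ (suc n) (λ r → ∑ (suc n) (λ s → + reversedInd (suc n) C j r s))
      ≡⟨ ∑□≡∑Δ _ (ℕ.n≤1+n n) (cong +_ ∘ reversedInd-outside C j) ⟩
    ∑Δ n (λ r s → + reversedInd (suc n) C j r s)
      ≡⟨ ∑Δ-cong n (cong +_ ∘ reversedInd-inside C j ∘ s≤s) ⟩
    ∑Δ n (λ r s → + allColor j (colour C hor r (suc s)) (colour C up (suc r) s) (colour C dia r s)) ∎

  count≡∑ : ∀ n x c → + count n x c ≡ ∑ n (λ r → + [ x r ≟c c ])
  count≡∑ n x c = Σ<-∑ n (λ r → [ x r ≟c c ])

  module _ {n n₀ : ℕ} {C : ColorMap (suc n)} (isC : IsColorMap (suc n) C)
           (bottom : BinarySide (suc n) (bottomSide C) n₀)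
           (left   : BinarySide (suc n) (leftSide C) n₀)
           (right  : BinarySide (suc n) (rightSide C) n₀) where

    private
      D R : ℕ
      D = directMono (suc n) C c0
      R = reversedMono (suc n) C c0

      directMonoAt reversedMonoAt : ℕ → ℕ → ℤ
      directMonoAt r s   = + allColor c0 (colour C up r s) (colour C dia r s) (colour C hor r s)
      reversedMonoAt r s = + allColor c0 (colour C hor r (suc s)) (colour C up (suc r) s) (colour C dia r s)

      reversedMonoAt-rotated : ∀ r s →
        + allColor c0 (colour C up (suc r) s) (colour C dia r s) (colour C hor r (suc s)) ≡ reversedMonoAt r s
      reversedMonoAt-rotated r s =
        cong +_ (sym (allColor-rotate c0 (colour C hor r (suc s)) (colour C up (suc r) s) (colour C dia r s)))

      directFaces : ∀ {r s} → r ℕ.+ s < suc n →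
                    FaceLaws (colour C up r s) (colour C dia r s) (colour C hor r s)
      directFaces {r} {s} p = faceLaws (direct-Allowed {C = C} isC {r} {s} p)

      reversedFaces : ∀ {r s} → suc (r ℕ.+ s) < suc n →
                      FaceLaws (colour C up (suc r) s) (colour C dia r s) (colour C hor r (suc s))
      reversedFaces {r} {s} p = faceLaws (reversed-Allowed {C = C} isC {r} {s} p)

      zeros : ∀ {x} → BinarySide (suc n) x n₀ → ∑ (suc n) (λ r → + [ x r ≟c c0 ]) ≡ + n₀
      zeros {x} side = trans (sym (count≡∑ (suc n) x c0)) (cong +_ (BinarySide.zeros side))

      edgeWeight : Dir → ℕ → ℕ → ℤ
      edgeWeight e r s = weight (colour C e r s)

      directSum-weight : directSum n edgeWeight ≡ + 3 * + D
      directSum-weight = begin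
        directSum n edgeWeight
          ≡⟨ ∑Δ-cong (suc n) (λ {r} {s} p → FaceLaws.weighted (directFaces {r} {s} p)) ⟩
        ∑Δ (suc n) (λ r s → + 3 * directMonoAt r s) ≡⟨ ∑Δ-* (suc n) (+ 3) directMonoAt ⟩
        + 3 * ∑Δ (suc n) directMonoAt               ≡⟨ cong (_*_ (+ 3)) (sym (directMono≡∑Δ C c0)) ⟩
        + 3 * + D                                   ∎

      reversedFace-weight : ∀ {r s} → suc (r ℕ.+ s) < suc n →
        edgeWeight hor r (suc s) + edgeWeight up (suc r) s + edgeWeight dia r s ≡ + 3 * reversedMonoAt r s
      reversedFace-weight {r} {s} p = begin
        edgeWeight hor r (suc s) + edgeWeight up (suc r) s + edgeWeight dia r s
          ≡⟨ xy∙z≈xz∙y (edgeWeight hor r (suc s)) _ _ ⟩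
        edgeWeight hor r (suc s) + edgeWeight dia r s + edgeWeight up (suc r) s
          ≡⟨ FaceLaws.weighted (reversedFaces p) ⟩
        + 3 * + allColor c0 (colour C up (suc r) s) (colour C dia r s) (colour C hor r (suc s))
          ≡⟨ cong (_*_ (+ 3)) (reversedMonoAt-rotated r s) ⟩
        + 3 * reversedMonoAt r s ∎

      reversedSum-weight : reversedSum n edgeWeight ≡ + 3 * + R
      reversedSum-weight = begin
        reversedSum n edgeWeight
          ≡⟨ ∑Δ-cong n (λ {r} {s} p → reversedFace-weight {r} {s} (s≤s p)) ⟩
        ∑Δ n (λ r s → + 3 * reversedMonoAt r s)   ≡⟨ ∑Δ-* n (+ 3) reversedMonoAt ⟩
        + 3 * ∑Δ n reversedMonoAt                 ≡⟨ cong (_*_ (+ 3)) (sym (reversedMono≡∑Δ C c0)) ⟩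
        + 3 * + R                                 ∎

      sideWeight : ∀ {x} → BinarySide (suc n) x n₀ → ∑ (suc n) (weight ∘ x) ≡ + n₀
      sideWeight side = trans (∑-cong (suc n) (weight-binary ∘ BinarySide.binary side)) (zeros side)

      boundarySum-weight : boundarySum n edgeWeight ≡ + n₀ + + n₀ + + n₀
      boundarySum-weight = cong₂ _+_ (cong₂ _+_ (sideWeight bottom) (sideWeight left)) (sideWeight right)

      edgeVectors : Dir → ℕ → ℕ → ℤ²
      edgeVectors e r s = edgeVector e (colour C e r s)

      closed : Closed (suc n) edgeVectors
      closed = record
        { direct   = λ {r} {s} p → FaceLaws.closed (directFaces {r} {s} p)
        ; reversed = λ {r} {s} p → FaceLaws.closed (reversedFaces {r} {s} p)
        }

      φ : ℕ → ℕ → ℤ²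
      φ = potential edgeVectors

      directSum-area : directSum n (shoelace φ) ≡ + D
      directSum-area = begin
        directSum n (shoelace φ)        ≡⟨ ∑Δ-cong (suc n) (λ {r} {s} → directFace-area {r} {s}) ⟩
        ∑Δ (suc n) directMonoAt         ≡⟨ sym (directMono≡∑Δ C c0) ⟩
        + D                             ∎
        where
        directFace-area : ∀ {r s} → r ℕ.+ s < suc n →
                          shoelace φ hor r s + shoelace φ dia r s + shoelace φ up r s ≡ directMonoAt r s
        directFace-area {r} {s} p =
          trans (shoelace-direct φ (potential-hor closed {r} {s} p) refl) (FaceLaws.area (directFaces {r} {s} p))

      reversedFace-area : ∀ {r s} → suc (r ℕ.+ s) < suc n →
        shoelace φ hor r (suc s) + shoelace φ up (suc r) s + shoelace φ dia r s ≡ -1ℤ * reversedMonoAt r s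
      reversedFace-area {r} {s} p = begin
        shoelace φ hor r (suc s) + shoelace φ up (suc r) s + shoelace φ dia r s
          ≡⟨ shoelace-reversed φ (potential-hor closed {r} {suc s} (revHorBound r s p))
                                 (potential-dia closed {r} {s} (revDiaBound r s p)) ⟩
        cross h d                   ≡⟨ cross-closed u d (FaceLaws.closed faces) ⟩
        -1ℤ * cross h u             ≡⟨ cong (_*_ -1ℤ) (trans (FaceLaws.area faces) (reversedMonoAt-rotated r s)) ⟩
        -1ℤ * reversedMonoAt r s    ∎
        where
        faces : FaceLaws (colour C up (suc r) s) (colour C dia r s) (colour C hor r (suc s))
        faces = reversedFaces {r} {s} p
        h u d : ℤ²
        h = edgeVectors hor r (suc s)
        u = edgeVectors up (suc r) s
        d = edgeVectors dia r s

      reversedSum-area : reversedSum n (shoelace φ) ≡ -1ℤ * + R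
      reversedSum-area = begin
        reversedSum n (shoelace φ)
          ≡⟨ ∑Δ-cong n (λ {r} {s} p → reversedFace-area {r} {s} (s≤s p)) ⟩
        ∑Δ n (λ r s → -1ℤ * reversedMonoAt r s)   ≡⟨ ∑Δ-* n -1ℤ reversedMonoAt ⟩
        -1ℤ * ∑Δ n reversedMonoAt                 ≡⟨ cong (_*_ -1ℤ) (sym (reversedMono≡∑Δ C c0)) ⟩
        -1ℤ * + R                                 ∎

      bottomZeros leftZeros rightZeros : ℕ → ℤ
      bottomZeros i = + [ bottomSide C i ≟c c0 ]
      leftZeros   i = + [ leftSide C i ≟c c0 ]
      rightZeros  i = + [ rightSide C i ≟c c0 ]

      φ-bottom : ∀ {r} → r ≤ suc n → φ r 0 ≡ (∑ r bottomZeros , 0ℤ)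
      φ-bottom = potential-bottom edgeVectors (edgeVector-hor-binary ∘ BinarySide.binary bottom)

      φ-left : ∀ {s} → s ≤ suc n → φ 0 s ≡ (0ℤ , ∑ s leftZeros)
      φ-left = potential-left edgeVectors (edgeVector-up-binary ∘ BinarySide.binary left)

      xy-φ-corner : xy (φ (suc n) 0) ≡ + n₀
      xy-φ-corner = trans (cong xy (φ-bottom ℕ.≤-refl)) (trans (ℤ.+-identityʳ _) (zeros bottom))

      xy-rightEdge : ∀ {r k} → suc (r ℕ.+ k) ≡ suc n → xy (edgeVectors dia r k) ≡ 0ℤ
      xy-rightEdge {r} {k} r+k+1≡1+n =
        xy-edgeVector-dia-binary (subst (Binary ∘ colour C dia r) n∸r≡k (BinarySide.binary right r<1+n))
        where
        r+k≡n : r ℕ.+ k ≡ n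
        r+k≡n = ℕ.suc-injective r+k+1≡1+n
        n∸r≡k : n ∸ r ≡ k
        n∸r≡k = trans (cong (_∸ r) (sym r+k≡n)) (ℕ.m+n∸m≡n r k)
        r<1+n : r < suc n
        r<1+n = s≤s (subst (r ≤_) r+k≡n (ℕ.m≤m+n r k))

      rightEdge-area : ∀ {r} → r < suc n → shoelace φ dia r (n ∸ r) ≡ + n₀ * rightZeros r
      rightEdge-area {r} r<1+n = begin
        cross (φ (suc r) (n ∸ r)) p
          ≡⟨ cong (λ q → cross q p) (potential-dia closed {r} {n ∸ r} (rightBound r r<1+n)) ⟩
        cross (p +ᵥ edgeVectors dia r (n ∸ r)) p
          ≡⟨ cong (λ d → cross (p +ᵥ d) p) (edgeVector-dia-binary (BinarySide.binary right r<1+n)) ⟩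
        cross (p +ᵥ (δ , - δ)) p
          ≡⟨ cross-antidiagonal p δ ⟩
        xy p * δ
          ≡⟨ cong (_* δ) (trans (potential-antidiagonal closed (λ {r} {k} → xy-rightEdge {r} {k})
                                                        (suc (n ∸ r)) {r} onRightSide)
                                xy-φ-corner) ⟩
        + n₀ * δ ∎
        where
        p : ℤ²
        p = φ r (suc (n ∸ r))
        δ : ℤ
        δ = rightZeros r
        onRightSide : r ℕ.+ suc (n ∸ r) ≡ suc n
        onRightSide = trans (ℕ.+-suc r (n ∸ r)) (cong suc (ℕ.m+[n∸m]≡n (ℕ.s≤s⁻¹ r<1+n)))

      boundarySum-area : boundarySum n (shoelace φ) ≡ + n₀ * + n₀
      boundarySum-area = begin
        boundarySum n (shoelace φ)   ≡⟨ cong₂ _+_ (cong₂ _+_ bottomSide-area leftSide-area) rightSide-area ⟩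
        0ℤ + 0ℤ + + n₀ * + n₀        ≡⟨ ℤ.+-identityˡ _ ⟩
        + n₀ * + n₀                  ∎
        where
        bottomSide-area : ∑ (suc n) (λ r → shoelace φ hor r 0) ≡ 0ℤ
        bottomSide-area = ∑-0 (suc n) λ {r} r<1+n →
          trans (cong₂ cross (φ-bottom {r} (ℕ.<⇒≤ r<1+n)) (φ-bottom {suc r} r<1+n))
                (cross-x-axis (∑ r bottomZeros) (∑ (suc r) bottomZeros))
        leftSide-area : ∑ (suc n) (shoelace φ up 0) ≡ 0ℤ
        leftSide-area = ∑-0 (suc n) λ {s} s<1+n →
          trans (cong₂ cross (φ-left {suc s} s<1+n) (φ-left {s} (ℕ.<⇒≤ s<1+n)))
                (cross-y-axis (∑ (suc s) leftZeros) (∑ s leftZeros))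
        rightSide-area : ∑ (suc n) (λ r → shoelace φ dia r (n ∸ r)) ≡ + n₀ * + n₀
        rightSide-area = begin
          ∑ (suc n) (λ r → shoelace φ dia r (n ∸ r))   ≡⟨ ∑-cong (suc n) rightEdge-area ⟩
          ∑ (suc n) (λ r → + n₀ * rightZeros r)        ≡⟨ ∑-* (suc n) (+ n₀) rightZeros ⟩
          + n₀ * ∑ (suc n) rightZeros                  ≡⟨ cong (_*_ (+ n₀)) (zeros right) ⟩
          + n₀ * + n₀                                  ∎

    directMono≡reversedMono+n₀ : D ≡ R ℕ.+ n₀
    directMono≡reversedMono+n₀ = ℤ.+-injective (ℤ.*-cancelˡ-≡ (+ 3) (+ D) (+ (R ℕ.+ n₀)) (begin
      + 3 * + D                                               ≡⟨ sym directSum-weight ⟩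
      directSum n edgeWeight                                  ≡⟨ directSum≡reversedSum+boundarySum n edgeWeight ⟩
      reversedSum n edgeWeight + boundarySum n edgeWeight     ≡⟨ cong₂ _+_ reversedSum-weight boundarySum-weight ⟩
      + 3 * + R + (+ n₀ + + n₀ + + n₀)                        ≡⟨ identity (+ R) (+ n₀) ⟩
      + 3 * (+ R + + n₀)                                      ≡⟨ cong (_*_ (+ 3)) (sym (ℤ.pos-+ R n₀)) ⟩
      + 3 * + (R ℕ.+ n₀)                                      ∎))
      where
      identity : ∀ x m → + 3 * x + (m + m + m) ≡ + 3 * (x + m)
      identity = ℤ-Solver.solve-∀

    directMono+reversedMono≡n₀² : D ℕ.+ R ≡ n₀ ℕ.* n₀
    directMono+reversedMono≡n₀² = ℤ.+-injective (begin
      + (D ℕ.+ R)                                                   ≡⟨ ℤ.pos-+ D R ⟩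
      + D + + R
        ≡⟨ cong (_+ + R) (sym directSum-area) ⟩
      directSum n (shoelace φ) + + R
        ≡⟨ cong (_+ + R) (directSum≡reversedSum+boundarySum n (shoelace φ)) ⟩
      reversedSum n (shoelace φ) + boundarySum n (shoelace φ) + + R
        ≡⟨ cong₂ (λ a b → a + b + + R) reversedSum-area boundarySum-area ⟩
      -1ℤ * + R + + n₀ * + n₀ + + R                                 ≡⟨ identity (+ R) (+ n₀ * + n₀) ⟩
      + n₀ * + n₀                                                   ≡⟨ sym (ℤ.pos-* n₀ n₀) ⟩
      + (n₀ ℕ.* n₀)                                                 ∎)
      where
      identity : ∀ x a → -1ℤ * x + a + x ≡ a
      identity = ℤ-Solver.solve-∀

-- Counting monochromatic faces

open import Data.Nat.Base using (_+_; _*_; _/_; _≥_)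
open import Data.Nat.DivMod using (m*n/n≡m)
open import Relation.Binary.PropositionalEquality using (subst₂)
open ≡-Reasoning

triangularCounts : ∀ {D R m} → D ≡ R + m → D + R ≡ m * m → D ≡ m * (m + 1) / 2 × R ≡ m * (m ∸ 1) / 2
triangularCounts {R = R} {m} refl D+R≡m² = halve D*2≡m[m+1] , halve R*2≡m[m-1]
  where
  halve : ∀ {x y} → x * 2 ≡ y → x ≡ y / 2
  halve {x} refl = sym (m*n/n≡m x 2)

  R*2+m≡m² : R * 2 + m ≡ m * m
  R*2+m≡m² = trans (identity R m) D+R≡m²
    where
    identity : ∀ R m → R * 2 + m ≡ R + m + R
    identity = ℕ-Solver.solve-∀

  D*2≡m[m+1] : (R + m) * 2 ≡ m * (m + 1)
  D*2≡m[m+1] = begin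
    (R + m) * 2       ≡⟨ identity₁ R m ⟩
    R * 2 + m + m     ≡⟨ cong (_+ m) R*2+m≡m² ⟩
    m * m + m         ≡⟨ identity₂ m ⟩
    m * (m + 1)       ∎
    where
    identity₁ : ∀ R m → (R + m) * 2 ≡ R * 2 + m + m
    identity₁ = ℕ-Solver.solve-∀
    identity₂ : ∀ m → m * m + m ≡ m * (m + 1)
    identity₂ = ℕ-Solver.solve-∀

  R*2≡m[m-1] : R * 2 ≡ m * (m ∸ 1)
  R*2≡m[m-1] = begin
    R * 2             ≡⟨ sym (ℕ.m+n∸n≡m (R * 2) m) ⟩
    R * 2 + m ∸ m     ≡⟨ cong (_∸ m) R*2+m≡m² ⟩
    m * m ∸ m         ≡⟨ cong (m * m ∸_) (sym (ℕ.*-identityʳ m)) ⟩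
    m * m ∸ m * 1     ≡⟨ sym (ℕ.*-distribˡ-∸ m m 1) ⟩
    m * (m ∸ 1)       ∎

monochromatic-c0 : ∀ {n n₀ n₁} {C : ColorMap (suc n)} → IsColorMap (suc n) C → n₀ + n₁ ≡ suc n →
                   SideCounts (suc n) C c0 n₀ → SideCounts (suc n) C c1 n₁ →
                   directMono (suc n) C c0 ≡ n₀ * (n₀ + 1) / 2 × reversedMono (suc n) C c0 ≡ n₀ * (n₀ ∸ 1) / 2
monochromatic-c0 {n} {n₀} {C = C} isC n₀+n₁≡n (bottom₀ , right₀ , left₀) (bottom₁ , right₁ , left₁) =
  triangularCounts (directMono≡reversedMono+n₀ isC bottom left right)
                   (directMono+reversedMono≡n₀² isC bottom left right)
  where
  bottom : BinarySide (suc n) (bottomSide C) n₀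
  bottom = binarySide (trans (sym (bottomCount≡count C c0)) bottom₀)
                      (trans (sym (bottomCount≡count C c1)) bottom₁) n₀+n₁≡n
  left : BinarySide (suc n) (leftSide C) n₀
  left = binarySide (trans (sym (leftCount≡count C c0)) left₀)
                    (trans (sym (leftCount≡count C c1)) left₁) n₀+n₁≡n
  right : BinarySide (suc n) (rightSide C) n₀
  right = binarySide (trans (sym (rightCount≡count C c0)) right₀)
                     (trans (sym (rightCount≡count C c1)) right₁) n₀+n₁≡n

monochromatic-c1 : ∀ {n n₀ n₁} {C : ColorMap (suc n)} → IsColorMap (suc n) C → n₀ + n₁ ≡ suc n →
                   SideCounts (suc n) C c0 n₀ → SideCounts (suc n) C c1 n₁ →
                   directMono (suc n) C c1 ≡ n₁ * (n₁ + 1) / 2 × reversedMono (suc n) C c1 ≡ n₁ * (n₁ ∸ 1) / 2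
monochromatic-c1 {n₀ = n₀} {n₁} {C} isC n₀+n₁≡n sides₀ sides₁ =
  subst₂ (λ d r → d ≡ n₁ * (n₁ + 1) / 2 × r ≡ n₁ * (n₁ ∸ 1) / 2)
         (directMono-swap01 C c1) (reversedMono-swap01 C c1)
         (monochromatic-c0 (IsColorMap-swap01 {C = C} isC) (trans (ℕ.+-comm n₁ n₀) n₀+n₁≡n)
                           (SideCounts-swap01 {C = C} sides₁) (SideCounts-swap01 {C = C} sides₀))

corollary5p6 : (n n₀ n₁ : ℕ) → n ≥ 1 → n₀ + n₁ ≡ n →
    (C : ColorMap n) → IsColorMap n C →
    bottomCount n C c0 ≡ n₀ → bottomCount n C c1 ≡ n₁ →
    rightCount n C c0 ≡ n₀ → rightCount n C c1 ≡ n₁ →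
    leftCount n C c0 ≡ n₀ → leftCount n C c1 ≡ n₁ →
    (directMono n C c0 ≡ n₀ * (n₀ + 1) / 2) × (reversedMono n C c0 ≡ n₀ * (n₀ ∸ 1) / 2)
    × (directMono n C c1 ≡ n₁ * (n₁ + 1) / 2) × (reversedMono n C c1 ≡ n₁ * (n₁ ∸ 1) / 2)
corollary5p6 zero    _  _  ()
corollary5p6 (suc n) n₀ n₁ _ n₀+n₁≡n C isC bottom₀ bottom₁ right₀ right₁ left₀ left₁ =
  let direct₀ , reversed₀ = monochromatic-c0 isC n₀+n₁≡n sides₀ sides₁
  in  direct₀ , reversed₀ , monochromatic-c1 isC n₀+n₁≡n sides₀ sides₁
  where
  sides₀ : SideCounts (suc n) C c0 n₀
  sides₀ = bottom₀ , right₀ , left₀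
  sides₁ : SideCounts (suc n) C c1 n₁
  sides₁ = bottom₁ , right₁ , left₁
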